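{- Let $X_{13}$ be the tournament with vertex set $\{0,1,\dots,12\}$ in which $ij$ is an arc if and only if $j-i \in \{1,2,3,5,6,9\}$ modulo $13$. Let $A$ be a set of four vertices inducing a transitive tournament $TT_4$ in $X_{13}$ such that the two vertices of $A$ with highest out-degree within $A$ form the set $\{0,1\}$ or the set $\{0,2\}$. Then $A$ is one of $\{0,1,2,3\}$, $\{0,1,3,6\}$, $\{0,1,6,2\}$, $\{0,2,3,5\}$. Moreover, the four tournaments obtained from $X_{13}$ by deleting each of these four sets are pairwise non-isomorphic, and each of them has no non-trivial automorphism.
   Context: A tournament is an orientation of a complete graph. $TT_k$ denotes the transitive tournament on $k$ vertices (the tournament with a linear order of its vertices in which every arc goes from the earlier to the later vertex). -}

module Defs where

open import Data.Bool using (Bool; true; false)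
open import Data.Nat using (ℕ; zero; suc; _+_; _∸_; _<_)
open import Data.Nat.DivMod using (_%_)
open import Data.Fin using (Fin; toℕ; #_; _<?_)
open import Data.Fin.Subset using (Subset; inside; _∈_; _∉_; _⊆_; ∣_∣; _∩_; _∪_; ⁅_⁆; ∁)
open import Data.Vec using (lookup; tabulate)
open import Data.Product using (Σ; _×_)
open import Function.Bundles using (_↔_; Inverse)
open import Relation.Binary.PropositionalEquality using (_≡_)
open import Relation.Nullary.Decidable using (⌊_⌋)

-- A tournament: a vertex type with a (Boolean) arc relation.
-- (Tournament axioms are not enforced; all tournaments used below are concrete.)
record Tournament : Set₁ where
  field
    V   : Set
    arc : V → V → Bool
open Tournament public

TT : ℕ → Tournament
TT k = record { V = Fin k ; arc = λ i j → ⌊ i <? j ⌋ }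

conn : ℕ → Bool
conn 1 = true
conn 2 = true
conn 3 = true
conn 5 = true
conn 6 = true
conn 9 = true
conn _ = false

diff13 : Fin 13 → Fin 13 → ℕ
diff13 i j = ((13 + toℕ j) ∸ toℕ i) % 13

arcX : Fin 13 → Fin 13 → Bool
arcX i j = conn (diff13 i j)

X13 : Tournament
X13 = record { V = Fin 13 ; arc = arcX }

induced : ∀ {n} → (Fin n → Fin n → Bool) → Subset n → Tournament
induced {n} a S = record
  { V   = Σ (Fin n) (λ v → lookup S v ≡ inside)
  ; arc = λ x y → a (Σ.proj₁ x) (Σ.proj₁ y) }

deleteX : Subset 13 → Tournament
deleteX A = induced arcX (∁ A)

_≅_ : Tournament → Tournament → Set
T ≅ U = Σ (V T ↔ V U) (λ φ → ∀ x y → arc T x y ≡ arc U (Inverse.to φ x) (Inverse.to φ y))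

Rigid : Tournament → Set
Rigid T = (α : T ≅ T) → ∀ x → Inverse.to (Σ.proj₁ α) x ≡ x

outdegIn : Subset 13 → Fin 13 → ℕ
outdegIn A v = ∣ A ∩ tabulate (arcX v) ∣

TopTwo : Subset 13 → Subset 13 → Set
TopTwo A S = S ⊆ A × ∣ S ∣ ≡ 2 ×
  (∀ v s → v ∈ A → v ∉ S → s ∈ S → outdegIn A v < outdegIn A s)

set2 : Fin 13 → Fin 13 → Subset 13
set2 a b = ⁅ a ⁆ ∪ ⁅ b ⁆

set4 : Fin 13 → Fin 13 → Fin 13 → Fin 13 → Subset 13
set4 a b c d = ⁅ a ⁆ ∪ (⁅ b ⁆ ∪ (⁅ c ⁆ ∪ ⁅ d ⁆))

cand : Fin 4 → Subset 13
cand Fin.zero = set4 (# 0) (# 1) (# 2) (# 3)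
cand (Fin.suc Fin.zero) = set4 (# 0) (# 1) (# 3) (# 6)
cand (Fin.suc (Fin.suc Fin.zero)) = set4 (# 0) (# 1) (# 6) (# 2)
cand (Fin.suc (Fin.suc (Fin.suc Fin.zero))) = set4 (# 0) (# 2) (# 3) (# 5)

{-# OPTIONS --safe #-}
-- A copy of TT_4 spanned by A lists A as a quadruple of
-- vertices that is transitive in X13, and exhausting all such quadruples proves
-- the first claim. An isomorphism X13 - S ≅ X13 - U restricts to a map of vertex
-- sets that preserves arcs; such maps are searched for by assigning images one
-- vertex at a time, pruning as soon as an arc to an already assigned vertex is
-- not preserved. The exhausted search rules out isomorphisms between distinct
-- candidates, and automorphisms moving any given vertex.
module Submission where

open import Defs
open import Data.Fin using (Fin; #_)
open import Data.Fin.Subset using (Subset)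
open import Data.Product using (Σ; _×_)
open import Data.Sum using (_⊎_)
open import Relation.Binary.PropositionalEquality using (_≡_; _≢_)
open import Relation.Nullary using (¬_)

open import Axiom.UniquenessOfIdentityProofs using (module Decidable⇒UIP)
open import Data.Bool using (Bool; true; false; T; not; _∧_; _∨_; if_then_else_)
open import Data.Bool.ListAction using (all)
import Data.Bool.Properties as Bool
open import Data.Fin.Properties using (_≟_; _<?_; all?; any?)
open import Data.Fin.Subset using (inside; ∁; _∈_; _⊆_; _∪_; ⁅_⁆; ∣_∣)
open import Data.Fin.Subset.Properties
  using (_∈?_; _⊆?_; x∈⁅x⁆; x∈⁅y⁆⇒x≡y; x∈p∪q⁻; p⊆p∪q; q⊆p∪q; ⊆-antisym)
open import Data.List using (List; []; _∷_; allFin)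
open import Data.List.Relation.Unary.All as All using (All; []; _∷_)
open import Data.List.Relation.Unary.All.Properties using (all⁺; all⁻; tabulate⁻)
open import Data.Nat using (ℕ)
import Data.Nat.Properties as ℕ
open import Data.Product using (∃; _,_; proj₁; proj₂)
open import Data.Sum using ([_,_])
open import Data.Vec using (lookup)
open import Data.Vec.Properties using ([]=⇒lookup; lookup⇒[]=; ≡-dec)
open import Function.Bundles using (Inverse; Equivalence)
open import Relation.Binary.PropositionalEquality using (refl; sym; trans; cong; cong₂; subst)
open import Relation.Nullary using (Dec; yes; no; contradiction)
open import Relation.Nullary.Decidable
  using (⌊_⌋; _×-dec_; _⊎-dec_; _→-dec_; ¬?; from-yes; decidable-stable; fromWitness)

open Decidable⇒UIP Bool._≟_ using (≡-irrelevant)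

private
  variable
    n : ℕ
    A B : Subset n
    x : Fin n

T-∧⁺ : ∀ {x y} → T x → T y → T (x ∧ y)
T-∧⁺ p q = Equivalence.from Bool.T-∧ (p , q)

T-implies : ∀ {x y} → T (not x ∨ y) → T x → T y
T-implies {true} h _ = h

_≟ₛ_ : (A B : Subset n) → Dec (A ≡ B)
_≟ₛ_ = ≡-dec Bool._≟_

⁅⁆-⊆ : x ∈ A → ⁅ x ⁆ ⊆ A
⁅⁆-⊆ {x = x} {A = A} x∈A y∈x = subst (_∈ A) (sym (x∈⁅y⁆⇒x≡y x y∈x)) x∈A

⁅⁆∪-⊆ : x ∈ A → B ⊆ A → ⁅ x ⁆ ∪ B ⊆ A
⁅⁆∪-⊆ x∈A B⊆A y∈ = [ ⁅⁆-⊆ x∈A , B⊆A ] (x∈p∪q⁻ _ _ y∈)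

record ArcPreserving (a b : Fin n → Fin n → Bool) (S U : Subset n) : Set where
  field
    map     : Fin n → Fin n
    map-∈   : x ∈ S → map x ∈ U
    map-arc : ∀ {x y} → x ∈ S → y ∈ S → a x y ≡ b (map x) (map y)

module _ {a b : Fin n → Fin n → Bool} {S U : Subset n} (φ : induced a S ≅ induced b U) where
  private
    to = Inverse.to (proj₁ φ)

  -- Off S the value is irrelevant; the identity is used.
  underlying : Fin n → Fin n
  underlying v with v ∈? S
  ... | yes v∈S = proj₁ (to (v , []=⇒lookup v∈S))
  ... | no _    = v

  underlying-to : ∀ v (p : lookup S v ≡ inside) → underlying v ≡ proj₁ (to (v , p))
  underlying-to v p with v ∈? S
  ... | yes v∈S = cong (λ q → proj₁ (to (v , q))) (≡-irrelevant _ p)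
  ... | no v∉S  = contradiction (lookup⇒[]= v S p) v∉S

  ≅⇒arcPreserving : ArcPreserving a b S U
  ≅⇒arcPreserving = record
    { map     = underlying
    ; map-∈   = λ {x} x∈S → let p = []=⇒lookup x∈S in
        subst (_∈ U) (sym (underlying-to x p)) (lookup⇒[]= _ U (proj₂ (to (x , p))))
    ; map-arc = λ {x} {y} x∈S y∈S → let p = []=⇒lookup x∈S; q = []=⇒lookup y∈S in
        trans (proj₂ φ (x , p) (y , q)) (sym (cong₂ b (underlying-to x p) (underlying-to y q)))
    }

module ArcPreservingSearch
  (a b : Fin n → Fin n → Bool) (S U : Subset n) (allowed : Fin n → Fin n → Bool) where

  PartialMap : Set
  PartialMap = List (Fin n × Fin n)

  extendable : PartialMap → Fin n → Fin n → Bool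
  extendable ps d c = lookup U c ∧ allowed d c ∧ all (λ (d′ , c′) → ⌊ a d d′ Bool.≟ b c c′ ⌋) ps

  exhausted : PartialMap → List (Fin n) → Bool
  exhausted ps []       = false
  exhausted ps (d ∷ ds) =
    if lookup S d
    then all (λ c → not (extendable ps d c) ∨ exhausted ((d , c) ∷ ps) ds) (allFin n)
    else exhausted ps ds

  module _ (f : ArcPreserving a b S U)
           (f-allowed : ∀ {d} → d ∈ S → T (allowed d (ArcPreserving.map f d))) where
    open ArcPreserving f

    Agrees : PartialMap → Set
    Agrees = All (λ (d , c) → d ∈ S × map d ≡ c)

    extendable-map : ∀ {ps d} → Agrees ps → d ∈ S → T (extendable ps d (map d))
    extendable-map agrees d∈S =
      T-∧⁺ (Equivalence.from Bool.T-≡ ([]=⇒lookup (map-∈ d∈S))) (T-∧⁺ (f-allowed d∈S)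
        (all⁻ _ (All.map (λ { (d′∈S , refl) → fromWitness (map-arc d∈S d′∈S) }) agrees)))

    exhausted-sound : ∀ ps ds → Agrees ps → ¬ T (exhausted ps ds)
    exhausted-sound ps (d ∷ ds) agrees h with lookup S d in S[d]
    ... | true  = exhausted-sound ((d , map d) ∷ ps) ds ((d∈S , refl) ∷ agrees)
                    (T-implies (tabulate⁻ (all⁺ _ (allFin n) h) (map d)) (extendable-map agrees d∈S))
      where d∈S = lookup⇒[]= d S S[d]
    ... | false = exhausted-sound ps ds agrees h

  exhausted⇒¬arcPreserving : T (exhausted [] (allFin n)) → (f : ArcPreserving a b S U) →
                             ¬ (∀ {d} → d ∈ S → T (allowed d (ArcPreserving.map f d)))
  exhausted⇒¬arcPreserving h f f-allowed = exhausted-sound f f-allowed [] (allFin n) [] h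

open ArcPreservingSearch using (exhausted; exhausted⇒¬arcPreserving)

vertex-≡ : {S : Subset n} {v w : Σ (Fin n) (λ x → lookup S x ≡ inside)} → proj₁ v ≡ proj₁ w → v ≡ w
vertex-≡ {v = x , p} {w = .x , q} refl = cong (x ,_) (≡-irrelevant p q)

exhausted⇒≇ : {a b : Fin n → Fin n → Bool} {S U : Subset n} →
             T (exhausted a b S U (λ _ _ → true) [] (allFin n)) → ¬ (induced a S ≅ induced b U)
exhausted⇒≇ {a = a} {b} {S} {U} h φ = exhausted⇒¬arcPreserving a b S U _ h (≅⇒arcPreserving φ) _

moves : Fin n → Fin n → Fin n → Bool
moves x d c = not (⌊ d ≟ x ⌋ ∧ ⌊ c ≟ x ⌋)

moves-map : {g : Fin n → Fin n} {x : Fin n} → g x ≢ x → ∀ d → T (moves x d (g d))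
moves-map {g = g} {x} moved d with d ≟ x
... | no _ = _
... | yes refl with g d ≟ d
...   | yes gd≡d = moved gd≡d
...   | no _     = _

exhausted⇒rigid : {a : Fin n → Fin n → Bool} {S : Subset n} →
                  (∀ x → x ∈ S → T (exhausted a a S S (moves x) [] (allFin n))) → Rigid (induced a S)
exhausted⇒rigid {a = a} {S} h α (x , p) =
  vertex-≡ {S = S} (trans (sym (underlying-to {a = a} {a} {S} {S} α x p)) fixes)
  where
  f : ArcPreserving a a S S
  f = ≅⇒arcPreserving α
  open ArcPreserving f

  fixes : map x ≡ x
  fixes = decidable-stable (map x ≟ x) λ moved →
    exhausted⇒¬arcPreserving a a S S (moves x) (h x (lookup⇒[]= x S p)) f (λ {d} _ → moves-map moved d)

set4-⊆ : {A : Subset 13} {a₀ a₁ a₂ a₃ : Fin 13} →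
         a₀ ∈ A → a₁ ∈ A → a₂ ∈ A → a₃ ∈ A → set4 a₀ a₁ a₂ a₃ ⊆ A
set4-⊆ h₀ h₁ h₂ h₃ = ⁅⁆∪-⊆ h₀ (⁅⁆∪-⊆ h₁ (⁅⁆∪-⊆ h₂ (⁅⁆-⊆ h₃)))

∈-set4 : (a : Fin 4 → Fin 13) (k : Fin 4) → a k ∈ set4 (a (# 0)) (a (# 1)) (a (# 2)) (a (# 3))
∈-set4 a Fin.zero = p⊆p∪q _ (x∈⁅x⁆ _)
∈-set4 a (Fin.suc Fin.zero) = q⊆p∪q _ _ (p⊆p∪q _ (x∈⁅x⁆ _))
∈-set4 a (Fin.suc (Fin.suc Fin.zero)) = q⊆p∪q _ _ (q⊆p∪q _ _ (p⊆p∪q _ (x∈⁅x⁆ _)))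
∈-set4 a (Fin.suc (Fin.suc (Fin.suc Fin.zero))) = q⊆p∪q _ _ (q⊆p∪q _ _ (q⊆p∪q _ _ (x∈⁅x⁆ _)))

set4-image : (a : Fin 4 → Fin 13) → (∀ k → a k ∈ A) → (∀ {v} → v ∈ A → ∃ λ k → a k ≡ v) →
             A ≡ set4 (a (# 0)) (a (# 1)) (a (# 2)) (a (# 3))
set4-image {A = A} a a∈A cover = ⊆-antisym A⊆ (set4-⊆ (a∈A (# 0)) (a∈A (# 1)) (a∈A (# 2)) (a∈A (# 3)))
  where
  A⊆ : A ⊆ set4 (a (# 0)) (a (# 1)) (a (# 2)) (a (# 3))
  A⊆ v∈A with cover v∈A
  ... | k , refl = ∈-set4 a k

TopTwo? : (A S : Subset 13) → Dec (TopTwo A S)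
TopTwo? A S =
  S ⊆? A ×-dec ∣ S ∣ ℕ.≟ 2 ×-dec
  all? λ v → all? λ s → v ∈? A →-dec ¬? (v ∈? S) →-dec s ∈? S →-dec outdegIn A v ℕ.<? outdegIn A s

TopTwo₀₁∨₀₂ : Subset 13 → Set
TopTwo₀₁∨₀₂ A = TopTwo A (set2 (# 0) (# 1)) ⊎ TopTwo A (set2 (# 0) (# 2))

IsCandidate : Subset 13 → Set
IsCandidate A = ∃ λ i → A ≡ cand i

transitive-quadruples-with-top-two :
  ∀ a₀ a₁ → T (arcX a₀ a₁) →
  ∀ a₂ → T (arcX a₀ a₂) → T (arcX a₁ a₂) →
  ∀ a₃ → T (arcX a₀ a₃) → T (arcX a₁ a₃) → T (arcX a₂ a₃) →
  TopTwo₀₁∨₀₂ (set4 a₀ a₁ a₂ a₃) → IsCandidate (set4 a₀ a₁ a₂ a₃)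
transitive-quadruples-with-top-two = from-yes
  (all? λ a₀ → all? λ a₁ → Bool.T? (arcX a₀ a₁) →-dec
   all? λ a₂ → Bool.T? (arcX a₀ a₂) →-dec Bool.T? (arcX a₁ a₂) →-dec
   all? λ a₃ → Bool.T? (arcX a₀ a₃) →-dec Bool.T? (arcX a₁ a₃) →-dec Bool.T? (arcX a₂ a₃) →-dec
   let A = set4 a₀ a₁ a₂ a₃ in
   (TopTwo? A (set2 (# 0) (# 1)) ⊎-dec TopTwo? A (set2 (# 0) (# 2))) →-dec
   any? λ i → A ≟ₛ cand i)

TT4-copy-with-top-two : (A : Subset 13) → TT 4 ≅ induced arcX A → TopTwo₀₁∨₀₂ A → IsCandidate A
TT4-copy-with-top-two A (φ , arc-≡) top = subst IsCandidate (sym A≡) (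
  transitive-quadruples-with-top-two
    (a (# 0)) (a (# 1)) (arc-image (# 0) (# 1) _)
    (a (# 2)) (arc-image (# 0) (# 2) _) (arc-image (# 1) (# 2) _)
    (a (# 3)) (arc-image (# 0) (# 3) _) (arc-image (# 1) (# 3) _) (arc-image (# 2) (# 3) _)
    (subst TopTwo₀₁∨₀₂ A≡ top))
  where
  open Inverse φ using (to; from; strictlyInverseˡ)

  a : Fin 4 → Fin 13
  a k = proj₁ (to k)

  arc-image : ∀ k l → T ⌊ k <? l ⌋ → T (arcX (a k) (a l))
  arc-image k l = subst T (arc-≡ k l)

  A≡ : A ≡ set4 (a (# 0)) (a (# 1)) (a (# 2)) (a (# 3))
  A≡ = set4-image a (λ k → lookup⇒[]= _ A (proj₂ (to k)))
         (λ {v} v∈A → let w = (v , []=⇒lookup v∈A) in from w , cong proj₁ (strictlyInverseˡ w))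

candidate-deletions-non-isomorphic : (i j : Fin 4) → i ≢ j → ¬ (deleteX (cand i) ≅ deleteX (cand j))
candidate-deletions-non-isomorphic i j i≢j =
  exhausted⇒≇ {a = arcX} {arcX} {∁ (cand i)} {∁ (cand j)} (exhausted-searches i j i≢j)
  where
  exhausted-searches : ∀ i j → i ≢ j →
    T (exhausted arcX arcX (∁ (cand i)) (∁ (cand j)) (λ _ _ → true) [] (allFin 13))
  exhausted-searches = from-yes (all? λ i → all? λ j → ¬? (i ≟ j) →-dec
    Bool.T? (exhausted arcX arcX (∁ (cand i)) (∁ (cand j)) (λ _ _ → true) [] (allFin 13)))

candidate-deletions-rigid : (i : Fin 4) → Rigid (deleteX (cand i))
candidate-deletions-rigid i = exhausted⇒rigid {a = arcX} {∁ (cand i)} (exhausted-searches i)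
  where
  exhausted-searches : ∀ i x → x ∈ ∁ (cand i) →
    T (exhausted arcX arcX (∁ (cand i)) (∁ (cand i)) (moves x) [] (allFin 13))
  exhausted-searches = from-yes (all? λ i → all? λ x → x ∈? ∁ (cand i) →-dec
    Bool.T? (exhausted arcX arcX (∁ (cand i)) (∁ (cand i)) (moves x) [] (allFin 13)))

proposition2p7 : ((A : Subset 13) → TT 4 ≅ induced arcX A →
                    (TopTwo A (set2 (# 0) (# 1)) ⊎ TopTwo A (set2 (# 0) (# 2))) →
                    Σ (Fin 4) (λ i → A ≡ cand i))
                 × ((i j : Fin 4) → i ≢ j → ¬ (deleteX (cand i) ≅ deleteX (cand j)))
                 × ((i : Fin 4) → Rigid (deleteX (cand i)))
proposition2p7 = TT4-copy-with-top-two , candidate-deletions-non-isomorphic , candidate-deletions-rigid
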